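{- For every formula $\varphi\in\mathcal L$ there exists a formula $\widetilde\varphi\in\mathcal L$ in $\bigcirc$-normal form such that $\varphi\leftrightarrow\widetilde\varphi$ is valid over the class of persistent models.
   Context: Formulas of $\mathcal L$ are generated by $\varphi::=p\mid\bot\mid\varphi\wedge\varphi\mid\varphi\vee\varphi\mid\varphi\to\varphi\mid\bigcirc\varphi\mid\Diamond\varphi\mid\Box\varphi\mid\varphi\,\mathcal U\,\varphi\mid\varphi\,\mathcal R\,\varphi$ over a countable set of propositional variables; $\varphi\leftrightarrow\psi:=(\varphi\to\psi)\wedge(\psi\to\varphi)$. A formula is in $\bigcirc$-normal form if every occurrence of $\bigcirc$ in it is within a subformula of the form $\bigcirc^i p$ with $p$ a propositional variable (i.e. $\bigcirc$ is applied only to variables or to $\bigcirc$-prefixed variables). A persistent dynamic poset is $(W,\preccurlyeq,S)$ with $W\neq\emptyset$, $\preccurlyeq$ a partial order, $S:W\to W$ such that $w\preccurlyeq v\Rightarrow S(w)\preccurlyeq S(v)$, and whenever $v\succcurlyeq S(w)$ there is $u\succcurlyeq w$ with $S(u)=v$. A persistent model adds $V$ assigning each world a set of variables, monotone along $\preccurlyeq$. Satisfaction: $w\models p$ iff $p\in V(w)$; $w\not\models\bot$; $\wedge,\vee$ classical; $w\models\varphi\to\psi$ iff for all $v\succcurlyeq w$, $v\models\varphi$ implies $v\models\psi$; $w\models\bigcirc\varphi$ iff $S(w)\models\varphi$; $w\models\Diamond\varphi$ iff $\exists k\ge0$, $S^k(w)\models\varphi$; $w\models\Box\varphi$ iff $\forall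 k\ge0$, $S^k(w)\models\varphi$; $w\models\varphi\,\mathcal U\,\psi$ iff $\exists k\ge0$ with $S^k(w)\models\psi$ and $S^i(w)\models\varphi$ for all $i<k$; $w\models\varphi\,\mathcal R\,\psi$ iff for all $k\ge0$, $S^k(w)\models\psi$ or $S^i(w)\models\varphi$ for some $i<k$. Valid over a class means true at every world of every model in the class. -}

module Defs where

open import Level using (Level; _⊔_)
open import Data.Nat using (ℕ; zero; suc; _<_; _≤_)
open import Data.Product using (Σ; ∃; _×_; _,_)
open import Data.Sum using (_⊎_)
open import Data.Empty using (⊥)
open import Relation.Binary.PropositionalEquality using (_≡_)
open import Relation.Binary.Structures using (IsPartialOrder)

data Formula : Set where
  var  : ℕ → Formula
  ⊥'   : Formula
  _∧'_ : Formula → Formula → Formula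
  _∨'_ : Formula → Formula → Formula
  _⇒_  : Formula → Formula → Formula
  ◯    : Formula → Formula
  ◇    : Formula → Formula
  □    : Formula → Formula
  _𝒰_  : Formula → Formula → Formula
  _ℛ_  : Formula → Formula → Formula

_⇔_ : Formula → Formula → Formula
φ ⇔ ψ = (φ ⇒ ψ) ∧' (ψ ⇒ φ)

data NextVar : Formula → Set where
  nv-var  : ∀ p → NextVar (var p)
  nv-next : ∀ {φ} → NextVar φ → NextVar (◯ φ)

data NextNF : Formula → Set where
  nf-var  : ∀ p → NextNF (var p)
  nf-bot  : NextNF ⊥'
  nf-and  : ∀ {φ ψ} → NextNF φ → NextNF ψ → NextNF (φ ∧' ψ)
  nf-or   : ∀ {φ ψ} → NextNF φ → NextNF ψ → NextNF (φ ∨' ψ)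
  nf-imp  : ∀ {φ ψ} → NextNF φ → NextNF ψ → NextNF (φ ⇒ ψ)
  nf-next : ∀ {φ} → NextVar φ → NextNF (◯ φ)
  nf-dia  : ∀ {φ} → NextNF φ → NextNF (◇ φ)
  nf-box  : ∀ {φ} → NextNF φ → NextNF (□ φ)
  nf-U    : ∀ {φ ψ} → NextNF φ → NextNF ψ → NextNF (φ 𝒰 ψ)
  nf-R    : ∀ {φ ψ} → NextNF φ → NextNF ψ → NextNF (φ ℛ ψ)

iter : ∀ {a} {A : Set a} → ℕ → (A → A) → A → A
iter zero    f x = x
iter (suc k) f x = f (iter k f x)

record PersistentModel (a ℓ : Level) : Set (Level.suc (a ⊔ ℓ)) where
  field
    W      : Set a
    _≼_    : W → W → Set ℓ
    isPO   : IsPartialOrder _≡_ _≼_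
    S      : W → W
    S-mono : ∀ {w v} → w ≼ v → S w ≼ S v
    S-back : ∀ {w v} → S w ≼ v → Σ W (λ u → (w ≼ u) × (S u ≡ v))
    V      : W → ℕ → Set ℓ
    V-mono : ∀ {w v p} → w ≼ v → V w p → V v p

module _ {a ℓ : Level} (M : PersistentModel a ℓ) where
  open PersistentModel M

  infix 4 _⊨_
  _⊨_ : W → Formula → Set (a ⊔ ℓ)
  w ⊨ var p   = Level.Lift a (V w p)
  w ⊨ ⊥'      = Level.Lift (a ⊔ ℓ) ⊥
  w ⊨ (φ ∧' ψ) = (w ⊨ φ) × (w ⊨ ψ)
  w ⊨ (φ ∨' ψ) = (w ⊨ φ) ⊎ (w ⊨ ψ)
  w ⊨ (φ ⇒ ψ)  = ∀ v → w ≼ v → v ⊨ φ → v ⊨ ψ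
  w ⊨ ◯ φ     = S w ⊨ φ
  w ⊨ ◇ φ     = ∃ λ k → iter k S w ⊨ φ
  w ⊨ □ φ     = ∀ k → iter k S w ⊨ φ
  w ⊨ (φ 𝒰 ψ)  = ∃ λ k → (iter k S w ⊨ ψ) × (∀ i → i < k → iter i S w ⊨ φ)
  w ⊨ (φ ℛ ψ)  = ∀ k → (iter k S w ⊨ ψ) ⊎ (∃ λ i → (i < k) × (iter i S w ⊨ φ))

ValidPersistent : Formula → Set₁
ValidPersistent φ = (M : PersistentModel Level.zero Level.zero) →
  (w : PersistentModel.W M) → _⊨_ M w φ

module Submission where

-- Idea: ◯ commutes with every connective of 𝓛 in a persistent model, so it
-- can be pushed down to the propositional variables.  We define a
-- translation  pushNext n φ  meant to express  ◯ⁿ φ : it carries a counter n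
-- of pending ◯'s, increments it when crossing a ◯ and deposits it as ◯ⁿ p at
-- each variable p.  Its output is always in ◯-normal form.
--
-- It
-- rests on two facts:
--   * iterates of S commute (Sⁿ ∘ Sᵏ = Sᵏ ∘ Sⁿ), which handles ◯ⁿ p and the
--     temporal operators, whose meaning depends only on the S-orbit;
--   * Sⁿ is again monotone and has the "backward" persistence property,
--     which is exactly what the intuitionistic implication case needs.

open import Defs
open import Level using (Level; _⊔_)
open import Data.Nat using (ℕ; zero; suc; _+_; _<_)
open import Data.Nat.Properties using (+-comm)
open import Data.Product using (Σ; _×_; _,_; map₂)
open import Data.Product.Function.NonDependent.Propositional using (_×-⇔_)
open import Data.Sum.Function.Propositional using (_⊎-⇔_)
open import Function.Bundles using (Equivalence; mk⇔) renaming (_⇔_ to _⟺_)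
open import Function.Construct.Composition using (_⇔-∘_)
open import Function.Construct.Identity using (⇔-id)
open import Relation.Binary.PropositionalEquality using (_≡_; refl; cong; sym)
open Relation.Binary.PropositionalEquality.≡-Reasoning

open Equivalence using (to; from)

pushNext : ℕ → Formula → Formula
pushNext n (var p)  = iter n ◯ (var p)
pushNext n ⊥'       = ⊥'
pushNext n (φ ∧' ψ) = pushNext n φ ∧' pushNext n ψ
pushNext n (φ ∨' ψ) = pushNext n φ ∨' pushNext n ψ
pushNext n (φ ⇒ ψ)  = pushNext n φ ⇒ pushNext n ψ
pushNext n (◯ φ)    = pushNext (suc n) φ
pushNext n (◇ φ)    = ◇ (pushNext n φ)
pushNext n (□ φ)    = □ (pushNext n φ)
pushNext n (φ 𝒰 ψ)  = pushNext n φ 𝒰 pushNext n ψ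
pushNext n (φ ℛ ψ)  = pushNext n φ ℛ pushNext n ψ

iter-◯-NextVar : ∀ n p → NextVar (iter n ◯ (var p))
iter-◯-NextVar zero    p = nv-var p
iter-◯-NextVar (suc n) p = nv-next (iter-◯-NextVar n p)

pushNext-NF : ∀ n φ → NextNF (pushNext n φ)
pushNext-NF zero    (var p)  = nf-var p
pushNext-NF (suc n) (var p)  = nf-next (iter-◯-NextVar n p)
pushNext-NF n       ⊥'       = nf-bot
pushNext-NF n       (φ ∧' ψ) = nf-and (pushNext-NF n φ) (pushNext-NF n ψ)
pushNext-NF n       (φ ∨' ψ) = nf-or (pushNext-NF n φ) (pushNext-NF n ψ)
pushNext-NF n       (φ ⇒ ψ)  = nf-imp (pushNext-NF n φ) (pushNext-NF n ψ)
pushNext-NF n       (◯ φ)    = pushNext-NF (suc n) φ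
pushNext-NF n       (◇ φ)    = nf-dia (pushNext-NF n φ)
pushNext-NF n       (□ φ)    = nf-box (pushNext-NF n φ)
pushNext-NF n       (φ 𝒰 ψ)  = nf-U (pushNext-NF n φ) (pushNext-NF n ψ)
pushNext-NF n       (φ ℛ ψ)  = nf-R (pushNext-NF n φ) (pushNext-NF n ψ)

iter-+ : ∀ {a} {A : Set a} (f : A → A) m k x →
         iter m f (iter k f x) ≡ iter (m + k) f x
iter-+ f zero    k x = refl
iter-+ f (suc m) k x = cong f (iter-+ f m k x)

iter-comm : ∀ {a} {A : Set a} (f : A → A) m k x →
            iter m f (iter k f x) ≡ iter k f (iter m f x)
iter-comm f m k x = begin
  iter m f (iter k f x)  ≡⟨ iter-+ f m k x ⟩
  iter (m + k) f x       ≡⟨ cong (λ j → iter j f x) (+-comm m k) ⟩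
  iter (k + m) f x       ≡⟨ sym (iter-+ f k m x) ⟩
  iter k f (iter m f x)  ∎

module _ {a ℓ : Level} (M : PersistentModel a ℓ) where
  open PersistentModel M

  private
    infix 4 _⊨′_
    _⊨′_ : W → Formula → Set (a ⊔ ℓ)
    _⊨′_ = _⊨_ M

  ⊨-≡ : ∀ {x y} φ → x ≡ y → (x ⊨′ φ) ⟺ (y ⊨′ φ)
  ⊨-≡ φ refl = ⇔-id _

  Sⁿ-mono : ∀ n {w v} → w ≼ v → iter n S w ≼ iter n S v
  Sⁿ-mono zero    w≼v = w≼v
  Sⁿ-mono (suc n) w≼v = S-mono (Sⁿ-mono n w≼v)

  Sⁿ-back : ∀ n {w u} → iter n S w ≼ u → Σ W (λ v → (w ≼ v) × (iter n S v ≡ u))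
  Sⁿ-back zero    {u = u} w≼u = u , w≼u , refl
  Sⁿ-back (suc n) Sⁿ⁺¹w≼u with S-back Sⁿ⁺¹w≼u
  ... | u′ , Sⁿw≼u′ , refl with Sⁿ-back n Sⁿw≼u′
  ...   | v , w≼v , refl = v , w≼v , refl

  ◯ⁿ-sat : ∀ n φ w → (w ⊨′ iter n ◯ φ) ⟺ (iter n S w ⊨′ φ)
  ◯ⁿ-sat zero    φ w = ⇔-id _
  ◯ⁿ-sat (suc n) φ w = ⊨-≡ φ (iter-comm S n 1 w) ⇔-∘ ◯ⁿ-sat n φ (S w)

  OrbitEquiv : W → Formula → W → Formula → Set (a ⊔ ℓ)
  OrbitEquiv w φ w′ φ′ = ∀ k → (iter k S w ⊨′ φ) ⟺ (iter k S w′ ⊨′ φ′)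

  -- The temporal operators only see truth values along orbits, so they
  -- respect OrbitEquiv.  (The formulas are explicit arguments because
  -- _⊨_ is not injective in them.)
  ◇-cong : ∀ {w w′} φ φ′ → OrbitEquiv w φ w′ φ′ → (w ⊨′ ◇ φ) ⟺ (w′ ⊨′ ◇ φ′)
  ◇-cong φ φ′ φ≈ = mk⇔ (map₂ (λ {k} → to (φ≈ k))) (map₂ (λ {k} → from (φ≈ k)))

  □-cong : ∀ {w w′} φ φ′ → OrbitEquiv w φ w′ φ′ → (w ⊨′ □ φ) ⟺ (w′ ⊨′ □ φ′)
  □-cong φ φ′ φ≈ = mk⇔ (λ h k → to (φ≈ k) (h k)) (λ h k → from (φ≈ k) (h k))

  module _ {w w′} φ ψ φ′ ψ′ (φ≈ : OrbitEquiv w φ w′ φ′) (ψ≈ : OrbitEquiv w ψ w′ ψ′) where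

    𝒰-cong : (w ⊨′ φ 𝒰 ψ) ⟺ (w′ ⊨′ φ′ 𝒰 ψ′)
    𝒰-cong = mk⇔
      (λ (k , ψk , φ<k) → k , to (ψ≈ k) ψk , λ i i<k → to (φ≈ i) (φ<k i i<k))
      (λ (k , ψk , φ<k) → k , from (ψ≈ k) ψk , λ i i<k → from (φ≈ i) (φ<k i i<k))

    ℛ-cong : (w ⊨′ φ ℛ ψ) ⟺ (w′ ⊨′ φ′ ℛ ψ′)
    ℛ-cong = mk⇔ (λ h k → to (ψ≈ k ⊎-⇔ releasedBefore k) (h k))
                 (λ h k → from (ψ≈ k ⊎-⇔ releasedBefore k) (h k))
      where
      releasedBefore : ∀ k → (Σ ℕ λ i → i < k × iter i S w ⊨′ φ)
                           ⟺ (Σ ℕ λ i → i < k × iter i S w′ ⊨′ φ′)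
      releasedBefore k = mk⇔ (map₂ (λ {i} → map₂ (to (φ≈ i))))
                             (map₂ (λ {i} → map₂ (from (φ≈ i))))

  -- It is proved
  -- together with its consequence along S-orbits, which is what the
  -- temporal operators consume: since Sᵏ and Sⁿ commute, Sᵏ(w) satisfies
  -- pushNext n φ iff Sᵏ(Sⁿ(w)) satisfies φ.
  pushNext-correct : ∀ n φ w → (w ⊨′ pushNext n φ) ⟺ (iter n S w ⊨′ φ)
  pushNext-orbit   : ∀ n φ w → OrbitEquiv w (pushNext n φ) (iter n S w) φ

  pushNext-orbit n φ w k =
    ⊨-≡ φ (iter-comm S n k w) ⇔-∘ pushNext-correct n φ (iter k S w)

  pushNext-correct n (var p)  w = ◯ⁿ-sat n (var p) w
  pushNext-correct n ⊥'       w = ⇔-id _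
  pushNext-correct n (φ ∧' ψ) w = pushNext-correct n φ w ×-⇔ pushNext-correct n ψ w
  pushNext-correct n (φ ∨' ψ) w = pushNext-correct n φ w ⊎-⇔ pushNext-correct n ψ w
  pushNext-correct n (◯ φ)    w = pushNext-correct (suc n) φ w
  pushNext-correct n (◇ φ)    w = ◇-cong (pushNext n φ) φ (pushNext-orbit n φ w)
  pushNext-correct n (□ φ)    w = □-cong (pushNext n φ) φ (pushNext-orbit n φ w)
  pushNext-correct n (φ 𝒰 ψ)  w = 𝒰-cong (pushNext n φ) (pushNext n ψ) φ ψ
                                         (pushNext-orbit n φ w) (pushNext-orbit n ψ w)
  pushNext-correct n (φ ℛ ψ)  w = ℛ-cong (pushNext n φ) (pushNext n ψ) φ ψ
                                         (pushNext-orbit n φ w) (pushNext-orbit n ψ w)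
  pushNext-correct n (φ ⇒ ψ)  w = mk⇔ forward backward
    where
    -- A successor u of Sⁿ(w) is Sⁿ(v) for a successor v of w (persistence).
    forward : w ⊨′ pushNext n φ ⇒ pushNext n ψ → iter n S w ⊨′ φ ⇒ ψ
    forward h u Sⁿw≼u u⊨φ with Sⁿ-back n Sⁿw≼u
    ... | v , w≼v , refl =
      to (pushNext-correct n ψ v) (h v w≼v (from (pushNext-correct n φ v) u⊨φ))

    -- A successor v of w gives the successor Sⁿ(v) of Sⁿ(w) (monotonicity).
    backward : iter n S w ⊨′ φ ⇒ ψ → w ⊨′ pushNext n φ ⇒ pushNext n ψ
    backward h v w≼v v⊨pφ =
      from (pushNext-correct n ψ v)
           (h (iter n S v) (Sⁿ-mono n w≼v) (to (pushNext-correct n φ v) v⊨pφ))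

mainTheorem10 : (φ : Formula) → Σ Formula (λ φ' → NextNF φ' × ValidPersistent (φ ⇔ φ'))
mainTheorem10 φ = pushNext 0 φ , pushNext-NF 0 φ , valid
  where
  valid : ValidPersistent (φ ⇔ pushNext 0 φ)
  valid M w = (λ v _ → from (pushNext-correct M 0 φ v))
            , (λ v _ → to (pushNext-correct M 0 φ v))
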